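{- Let $T$ be a tree on at least two vertices, and let $\ell(T)$ denote its number of leaves. Then $\mu(\mathrm{Cone}(T)) \leq \ell(T)-1$. More precisely, take the cone vertex $v_0$ of $\mathrm{Cone}(T)$ as the root vertex, so that $K(\mathrm{Cone}(T)) = \mathbb{Z}^{V-\{v_0\}}/\operatorname{im}\overline{L}$. Then for any choice of a leaf vertex $v_1$ of $T$, the group $K(\mathrm{Cone}(T))$ is generated by $\{\overline{e}_v : v \text{ a leaf of } T,\ v \neq v_1\}$, where $\overline{e}_v$ is the image of the standard basis vector $e_v$ of $\mathbb{Z}^{V-\{v_0\}}$.
   Context: For a finite connected graph $G=(V,E)$ (parallel edges allowed, no loops), the Laplacian $L_G \in \mathbb{Z}^{V\times V}$ has $(v,v)$-entry $\deg_G(v)$ and $(v,v')$-entry equal to minus the number of edges between $v$ and $v'$ for $v\neq v'$. For a chosen root vertex $v_0$, the reduced Laplacian $\overline{L}_G$ is the submatrix of $L_G$ obtained by deleting the row and column of $v_0$. The sandpile group is $K(G)=\mathbb{Z}^{V-\{v_0\}}/\operatorname{im}\overline{L}_G$ (its isomorphism type does not depend on $v_0$), and $\mu(G)$ denotes the minimal number of generators of $K(G)$. For a tree $T$ with vertices $v_1,\dots,v_n$, $\mathrm{Cone}(T)$ is the graph obtained from $T$ by adding a new cone vertex $v_0$ and one edge $\{v_0,v_i\}$ for each $i=1,\dots,n$. -}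

module Defs where

open import Data.Nat using (ℕ; zero; suc; _≤_)
open import Data.Integer using (ℤ; +_; -_; _+_; _*_)
open import Data.Fin using (Fin; zero; suc; inject₁; fromℕ; _≟_)
open import Data.Bool using (Bool; true; false; if_then_else_)
open import Data.Product using (Σ; ∃; _×_; _,_)
open import Relation.Binary.PropositionalEquality using (_≡_; _≢_)
open import Relation.Nullary using (¬_; does)
open import Function.Definitions using (Injective)

sumℕ : ∀ {m} → (Fin m → ℕ) → ℕ
sumℕ {zero}  f = 0
sumℕ {suc m} f = f zero Data.Nat.+ sumℕ (λ i → f (suc i))

sumℤ : ∀ {m} → (Fin m → ℤ) → ℤ
sumℤ {zero}  f = + 0
sumℤ {suc m} f = f zero + sumℤ (λ i → f (suc i))

-- Multigraphs on vertex set Fin m, given by edge multiplicities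
-- E i j = number of edges between i and j (symmetric, zero diagonal).

MultiGraph : ℕ → Set
MultiGraph m = Fin m → Fin m → ℕ

degree : ∀ {m} → MultiGraph m → Fin m → ℕ
degree E v = sumℕ (E v)

Laplacian : ∀ {m} → MultiGraph m → Fin m → Fin m → ℤ
Laplacian E i j = if does (i ≟ j) then + degree E i else - (+ E i j)

reducedLaplacian : ∀ {m} → MultiGraph (suc m) → Fin m → Fin m → ℤ
reducedLaplacian E i j = Laplacian E (suc i) (suc j)

_·_ : ∀ {m} → (Fin m → Fin m → ℤ) → (Fin m → ℤ) → Fin m → ℤ
(M · z) i = sumℤ (λ j → M i j * z j)

-- x ≡ y in K(G) = ℤ^{V - v0} / im L̄  (root v0 = vertex 0)
_≡[mod_]_ : ∀ {m} → (Fin m → ℤ) → MultiGraph (suc m) → (Fin m → ℤ) → Set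
x ≡[mod E ] y = ∃ λ z → ∀ i → x i + (- y i) ≡ (reducedLaplacian E · z) i

record SimpleGraph (n : ℕ) : Set where
  field
    adj       : Fin n → Fin n → Bool
    symmetric : ∀ i j → adj i j ≡ adj j i
    irrefl    : ∀ i → adj i i ≡ false
open SimpleGraph public

data Walk {n} (G : SimpleGraph n) : Fin n → Fin n → Set where
  here : ∀ {u} → Walk G u u
  step : ∀ {u w v} → adj G u w ≡ true → Walk G w v → Walk G u v

Connected : ∀ {n} → SimpleGraph n → Set
Connected G = ∀ u v → Walk G u v

-- a cycle of length k+3 ≥ 3: distinct vertices c 0, …, c (k+2),
-- consecutive ones adjacent, and the last adjacent to the first
record Cycle {n} (G : SimpleGraph n) : Set where
  field
    len   : ℕ
    verts : Fin (suc (suc (suc len))) → Fin n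
    inj   : Injective _≡_ _≡_ verts
    edges : ∀ (i : Fin (suc (suc len))) → adj G (verts (inject₁ i)) (verts (suc i)) ≡ true
    close : adj G (verts (fromℕ (suc (suc len)))) (verts zero) ≡ true

Acyclic : ∀ {n} → SimpleGraph n → Set
Acyclic G = ¬ Cycle G

IsTree : ∀ {n} → SimpleGraph n → Set
IsTree G = Connected G × Acyclic G

toMulti : ∀ {n} → SimpleGraph n → MultiGraph n
toMulti G i j = if adj G i j then 1 else 0

IsLeaf : ∀ {n} → SimpleGraph n → Fin n → Set
IsLeaf G v = degree (toMulti G) v ≡ 1

-- Cone(T): vertex 0 is the new cone vertex v0, vertex suc i is v_i of T
Cone : ∀ {n} → SimpleGraph n → MultiGraph (suc n)
Cone G zero    zero    = 0
Cone G zero    (suc j) = 1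
Cone G (suc i) zero    = 1
Cone G (suc i) (suc j) = toMulti G i j

e : ∀ {m} → Fin m → Fin m → ℤ
e v w = if does (v ≟ w) then + 1 else + 0

-- Let L̄ be the reduced Laplacian of Cone(T) and S the subgroup of ℤⁿ generated by im L̄ and the
-- e_v for leaves v ≠ v₁. Column v of L̄ is (deg v + 1) e_v − Σ_{q ∼ v} e_q, so if e_v and all but
-- one of the e_q (q ∼ v) lie in S, so does the remaining one. Peeling in this way, starting from
-- the leaves other than v₁, reaches every vertex: were it to stall, one could walk forever from an
-- unreached vertex along edges touching unreached vertices without ever backtracking, and such a
-- walk in a finite graph closes a cycle.

module Submission where

open import Defs

open import Data.Bool using (true; false; if_then_else_)
open import Data.Bool.Properties using (¬-not) renaming (_≟_ to _≟ᵇ_)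
open import Data.Fin using (Fin; zero; suc; _≟_; toℕ; fromℕ; fromℕ<; inject₁)
open import Data.Fin.Properties
  using (suc-injective; toℕ-fromℕ<; toℕ-fromℕ; toℕ-inject₁; toℕ-injective; toℕ<n; pigeonhole; any?; all?)
open import Data.Fin.Subset as Subset using (Subset; _∈_; _∉_; _⊂_; _⊃_; _∪_; ⁅_⁆; Lift)
open import Data.Fin.Subset.Induction using (⊃-wellFounded; Acc; acc)
open import Data.Fin.Subset.Properties using (_∈?_; ∉⊥; p⊆p∪q; x∈p∪q⁺; x∈p∪q⁻; x∈⁅x⁆; x∈⁅y⁆⇒x≡y)
open import Data.Integer as ℤ using (ℤ; +_; -_; _+_; _-_; _*_)
import Data.Integer.Properties as ℤ
open import Algebra.Properties.CommutativeSemigroup ℤ.+-commutativeSemigroup using (interchange)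
open import Algebra.Properties.CommutativeSemigroup ℤ.*-commutativeSemigroup using (x∙yz≈y∙xz)
open import Data.Integer.Tactic.RingSolver using (solve-∀)
open import Data.Nat as ℕ using (ℕ; zero; suc; _≤_; _<_; z≤n; s≤s)
import Data.Nat.Properties as ℕ
open import Data.Product using (∃; ∃₂; _×_; _,_; proj₁; proj₂)
open import Data.Sum using (_⊎_; inj₁; inj₂)
open import Function using (_∘_)
open import Level using (0ℓ)
open import Relation.Binary.Bundles using (Setoid)
open import Relation.Binary.Definitions using (tri<; tri≈; tri>)
open import Relation.Binary.PropositionalEquality
open import Relation.Nullary using (¬_; Dec; yes; no; contradiction; ¬?)
open import Relation.Nullary.Decidable using (_×-dec_; _⊎-dec_; _→-dec_; decidable-stable)

private
  variable
    m n : ℕ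

sumℤ-cong : {f g : Fin m → ℤ} → (∀ i → f i ≡ g i) → sumℤ f ≡ sumℤ g
sumℤ-cong {zero}  f≗g = refl
sumℤ-cong {suc m} f≗g = cong₂ _+_ (f≗g zero) (sumℤ-cong (f≗g ∘ suc))

sumℤ-zero : sumℤ {m} (λ _ → + 0) ≡ + 0
sumℤ-zero {zero}  = refl
sumℤ-zero {suc m} = trans (ℤ.+-identityˡ _) (sumℤ-zero {m})

sumℤ-+ : (f g : Fin m → ℤ) → sumℤ (λ i → f i + g i) ≡ sumℤ f + sumℤ g
sumℤ-+ {zero}  f g = refl
sumℤ-+ {suc m} f g = begin
  (f zero + g zero) + sumℤ (λ i → f (suc i) + g (suc i))
    ≡⟨ cong (_+_ (f zero + g zero)) (sumℤ-+ (f ∘ suc) (g ∘ suc)) ⟩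
  (f zero + g zero) + (sumℤ (f ∘ suc) + sumℤ (g ∘ suc))
    ≡⟨ interchange (f zero) (g zero) _ _ ⟩
  (f zero + sumℤ (f ∘ suc)) + (g zero + sumℤ (g ∘ suc)) ∎
  where open ≡-Reasoning

sumℤ-*ˡ : (k : ℤ) (f : Fin m → ℤ) → sumℤ (λ i → k * f i) ≡ k * sumℤ f
sumℤ-*ˡ {zero}  k f = sym (ℤ.*-zeroʳ k)
sumℤ-*ˡ {suc m} k f = begin
  k * f zero + sumℤ (λ i → k * f (suc i)) ≡⟨ cong (_+_ (k * f zero)) (sumℤ-*ˡ k (f ∘ suc)) ⟩
  k * f zero + k * sumℤ (f ∘ suc)          ≡⟨ ℤ.*-distribˡ-+ k (f zero) _ ⟨
  k * (f zero + sumℤ (f ∘ suc))            ∎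
  where open ≡-Reasoning

e-diag : (v : Fin n) → e v v ≡ + 1
e-diag v with v ≟ v
... | yes _   = refl
... | no v≢v = contradiction refl v≢v

e-off : {v w : Fin n} → v ≢ w → e v w ≡ + 0
e-off {v = v} {w} v≢w with v ≟ w
... | yes v≡w = contradiction v≡w v≢w
... | no _    = refl

sumℤ-*e : (c : Fin n → ℤ) (i : Fin n) → sumℤ (λ v → c v * e v i) ≡ c i
sumℤ-*e {suc n} c zero = begin
  c zero * + 1 + sumℤ (λ v → c (suc v) * + 0)
    ≡⟨ cong₂ _+_ (ℤ.*-identityʳ (c zero)) (sumℤ-cong (ℤ.*-zeroʳ ∘ c ∘ suc)) ⟩
  c zero + sumℤ {n} (λ _ → + 0) ≡⟨ cong (_+_ (c zero)) (sumℤ-zero {n}) ⟩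
  c zero + + 0                  ≡⟨ ℤ.+-identityʳ (c zero) ⟩
  c zero                        ∎
  where open ≡-Reasoning
sumℤ-*e {suc n} c (suc i) = begin
  c zero * + 0 + sumℤ (λ v → c (suc v) * e (suc v) (suc i)) ≡⟨ cong₂ _+_ (ℤ.*-zeroʳ (c zero)) refl ⟩
  + 0 + sumℤ (λ v → c (suc v) * e v i)                     ≡⟨ ℤ.+-identityˡ _ ⟩
  sumℤ (λ v → c (suc v) * e v i)                           ≡⟨ sumℤ-*e (c ∘ suc) i ⟩
  c (suc i)                                                ∎
  where open ≡-Reasoning

sumℕ-single : (f : Fin n → ℕ) (p : Fin n) → (∀ j → j ≢ p → f j ≡ 0) → sumℕ f ≡ f p
sumℕ-single f zero others = begin
  f zero ℕ.+ sumℕ (f ∘ suc) ≡⟨ cong (f zero ℕ.+_) (sumℕ-zero (f ∘ suc) (λ j → others (suc j) λ ())) ⟩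
  f zero ℕ.+ 0              ≡⟨ ℕ.+-identityʳ (f zero) ⟩
  f zero                    ∎
  where
  open ≡-Reasoning
  sumℕ-zero : (g : Fin m → ℕ) → (∀ j → g j ≡ 0) → sumℕ g ≡ 0
  sumℕ-zero {zero}  g g≗0 = refl
  sumℕ-zero {suc m} g g≗0 = cong₂ ℕ._+_ (g≗0 zero) (sumℕ-zero (g ∘ suc) (g≗0 ∘ suc))
sumℕ-single f (suc p) others =
  cong₂ ℕ._+_ (others zero λ ()) (sumℕ-single (f ∘ suc) p λ j j≢p → others (suc j) (j≢p ∘ suc-injective))

≤-sumℕ : (f : Fin n → ℕ) (j : Fin n) → f j ≤ sumℕ f
≤-sumℕ f zero    = ℕ.m≤m+n (f zero) _
≤-sumℕ f (suc j) = ℕ.≤-trans (≤-sumℕ (f ∘ suc) j) (ℕ.m≤n+m _ (f zero))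

module _ (M : Fin n → Fin n → ℤ) where

  ·-zero : ∀ i → (M · (λ _ → + 0)) i ≡ + 0
  ·-zero i = trans (sumℤ-cong (ℤ.*-zeroʳ ∘ M i)) (sumℤ-zero {n})

  ·-+ : ∀ z z′ i → (M · (λ j → z j + z′ j)) i ≡ (M · z) i + (M · z′) i
  ·-+ z z′ i = trans (sumℤ-cong λ j → ℤ.*-distribˡ-+ (M i j) (z j) (z′ j))
                     (sumℤ-+ (λ j → M i j * z j) (λ j → M i j * z′ j))

  ·-* : ∀ k z i → (M · (λ j → k * z j)) i ≡ k * (M · z) i
  ·-* k z i = trans (sumℤ-cong λ j → x∙yz≈y∙xz (M i j) k (z j)) (sumℤ-*ˡ k (λ j → M i j * z j))

  ·-e : ∀ v i → (M · e v) i ≡ M i v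
  ·-e v i = trans (sumℤ-cong λ j → cong (M i j *_) (e-sym v j)) (sumℤ-*e (M i) v)
    where
    e-sym : (v w : Fin n) → e v w ≡ e w v
    e-sym v w with v ≟ w | w ≟ v
    ... | yes _   | yes _   = refl
    ... | no _    | no _    = refl
    ... | yes v≡w | no w≢v = contradiction (sym v≡w) w≢v
    ... | no v≢w  | yes w≡v = contradiction (sym w≡v) v≢w

module Congruence (E : MultiGraph (suc n)) where

  private
    L̄ = reducedLaplacian E

    sub-sym : ∀ a b → b - a ≡ ℤ.-1ℤ * (a - b)
    sub-sym = solve-∀

    sub-trans : ∀ a b c → a - c ≡ (a - b) + (b - c)
    sub-trans = solve-∀

    sub-+ : ∀ a a′ b b′ → (a + b) - (a′ + b′) ≡ (a - a′) + (b - b′)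
    sub-+ = solve-∀

    sub-* : ∀ k a b → k * a - k * b ≡ k * (a - b)
    sub-* = solve-∀

  -- A record rather than x ≡[mod E ] y itself, so that x and y can be inferred from a proof.
  infix 4 _≈_
  record _≈_ (x y : Fin n → ℤ) : Set where
    constructor ≈-by
    field
      congruence : x ≡[mod E ] y

  ≈-reflexive : {x y : Fin n → ℤ} → (∀ i → x i ≡ y i) → x ≈ y
  ≈-reflexive {x} {y} x≗y = ≈-by ((λ _ → + 0) , λ i → begin
    x i - y i           ≡⟨ cong (_- y i) (x≗y i) ⟩
    y i - y i           ≡⟨ ℤ.+-inverseʳ (y i) ⟩
    + 0                 ≡⟨ ·-zero L̄ i ⟨
    (L̄ · (λ _ → + 0)) i ∎)
    where open ≡-Reasoning

  ≈-refl : {x : Fin n → ℤ} → x ≈ x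
  ≈-refl = ≈-reflexive λ _ → refl

  ≈-sym : {x y : Fin n → ℤ} → x ≈ y → y ≈ x
  ≈-sym {x} {y} (≈-by (z , x-y≡L̄z)) = ≈-by ((λ j → ℤ.-1ℤ * z j) , λ i →
    trans (sub-sym (x i) (y i)) (trans (cong (ℤ.-1ℤ *_) (x-y≡L̄z i)) (sym (·-* L̄ ℤ.-1ℤ z i))))

  ≈-trans : {x y w : Fin n → ℤ} → x ≈ y → y ≈ w → x ≈ w
  ≈-trans {x} {y} {w} (≈-by (z , x-y≡L̄z)) (≈-by (z′ , y-w≡L̄z′)) =
    ≈-by ((λ j → z j + z′ j) , λ i →
    trans (sub-trans (x i) (y i) (w i)) (trans (cong₂ _+_ (x-y≡L̄z i) (y-w≡L̄z′ i)) (sym (·-+ L̄ z z′ i))))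

  ≈-+ : {x x′ y y′ : Fin n → ℤ} → x ≈ x′ → y ≈ y′ → (λ i → x i + y i) ≈ (λ i → x′ i + y′ i)
  ≈-+ {x} {x′} {y} {y′} (≈-by (z , x-x′≡L̄z)) (≈-by (z′ , y-y′≡L̄z′)) =
    ≈-by ((λ j → z j + z′ j) , λ i →
    trans (sub-+ (x i) (x′ i) (y i) (y′ i))
          (trans (cong₂ _+_ (x-x′≡L̄z i) (y-y′≡L̄z′ i)) (sym (·-+ L̄ z z′ i))))

  ≈-* : (k : ℤ) {x y : Fin n → ℤ} → x ≈ y → (λ i → k * x i) ≈ (λ i → k * y i)
  ≈-* k {x} {y} (≈-by (z , x-y≡L̄z)) = ≈-by ((λ j → k * z j) , λ i →
    trans (sub-* k (x i) (y i)) (trans (cong (k *_) (x-y≡L̄z i)) (sym (·-* L̄ k z i))))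

  ≈-setoid : Setoid 0ℓ 0ℓ
  ≈-setoid = record
    { Carrier       = Fin n → ℤ
    ; _≈_           = _≈_
    ; isEquivalence = record { refl = ≈-refl ; sym = ≈-sym ; trans = ≈-trans }
    }

  column≈0 : (v : Fin n) → (λ i → L̄ i v) ≈ (λ _ → + 0)
  column≈0 v = ≈-by (e v , λ i → trans (ℤ.+-identityʳ (L̄ i v)) (sym (·-e L̄ v i)))

module Generation (E : MultiGraph (suc n)) (G : Fin n → Set) where

  open Congruence E

  Supported : (Fin n → ℤ) → Set
  Supported c = ∀ v → G v ⊎ c v ≡ + 0

  record Generated (y : Fin n → ℤ) : Set where
    constructor generated
    field
      coefficients : Fin n → ℤ
      supported    : Supported coefficients
      congruent    : y ≈ coefficients

  generated-resp : {x y : Fin n → ℤ} → x ≈ y → Generated y → Generated x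
  generated-resp x≈y (generated c supp y≈c) = generated c supp (≈-trans x≈y y≈c)

  generated-zero : Generated (λ _ → + 0)
  generated-zero = generated (λ _ → + 0) (λ _ → inj₂ refl) ≈-refl

  generated-e : ∀ {v} → G v → Generated (e v)
  generated-e {v} g = generated (e v) supp ≈-refl
    where
    supp : Supported (e v)
    supp w with v ≟ w
    ... | yes refl = inj₁ g
    ... | no _     = inj₂ refl

  generated-+ : {x y : Fin n → ℤ} → Generated x → Generated y → Generated (λ i → x i + y i)
  generated-+ (generated c supp x≈c) (generated d supp′ y≈d) =
    generated (λ i → c i + d i) supp+ (≈-+ x≈c y≈d)
    where
    supp+ : Supported (λ i → c i + d i)
    supp+ v with supp v | supp′ v
    ... | inj₁ g   | _        = inj₁ g
    ... | inj₂ _   | inj₁ g   = inj₁ g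
    ... | inj₂ c≡0 | inj₂ d≡0 = inj₂ (cong₂ _+_ c≡0 d≡0)

  generated-* : (k : ℤ) {x : Fin n → ℤ} → Generated x → Generated (λ i → k * x i)
  generated-* k (generated c supp x≈c) = generated (λ i → k * c i) supp* (≈-* k x≈c)
    where
    supp* : Supported (λ i → k * c i)
    supp* v with supp v
    ... | inj₁ g   = inj₁ g
    ... | inj₂ c≡0 = inj₂ (trans (cong (k *_) c≡0) (ℤ.*-zeroʳ k))

  generated-sum : (F : Fin m → Fin n → ℤ) → (∀ q → Generated (F q)) →
                  Generated (λ i → sumℤ (λ q → F q i))
  generated-sum {zero}  F gen = generated-zero
  generated-sum {suc m} F gen = generated-+ (gen zero) (generated-sum (F ∘ suc) (gen ∘ suc))

  generated-from-basis : (∀ v → Generated (e v)) → ∀ x → Generated x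
  generated-from-basis gen x = generated-resp (≈-reflexive (sym ∘ sumℤ-*e x))
    (generated-sum (λ v i → x v * e v i) (λ v → generated-* (x v) (gen v)))

no-loop : (G : SimpleGraph n) {x y : Fin n} → adj G x y ≡ true → x ≢ y
no-loop G {x} xy refl with () ← trans (sym xy) (irrefl G x)

module _ (T : SimpleGraph n) where

  private
    deg = degree (toMulti T)

  toMulti-sym : ∀ v w → toMulti T v w ≡ toMulti T w v
  toMulti-sym v w = cong (λ b → if b then 1 else 0) (symmetric T v w)

  toMulti-true : ∀ {v w} → adj T v w ≡ true → toMulti T v w ≡ 1
  toMulti-true = cong (λ b → if b then 1 else 0)

  toMulti-false : ∀ {v w} → adj T v w ≡ false → toMulti T v w ≡ 0
  toMulti-false = cong (λ b → if b then 1 else 0)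

  toMulti-≤1 : ∀ v w → toMulti T v w ≤ 1
  toMulti-≤1 v w with adj T v w
  ... | true  = ℕ.≤-refl
  ... | false = z≤n

  has-neighbour : ∀ {x} → 1 ≤ deg x → ∃ λ q → adj T x q ≡ true
  has-neighbour {x} 1≤deg with any? (λ q → adj T x q ≟ᵇ true)
  ... | yes found = found
  ... | no none   = contradiction (subst (1 ≤_) deg≡0 1≤deg) λ ()
    where
    deg≡0 : deg x ≡ 0
    deg≡0 = trans (sumℕ-single (toMulti T x) x λ q _ → toMulti-false (¬-not (none ∘ (q ,_))))
                  (toMulti-false (irrefl T x))

  has-other-neighbour : ∀ {x} → 2 ≤ deg x → ∀ p → ∃ λ q → q ≢ p × adj T x q ≡ true
  has-other-neighbour {x} 2≤deg p with any? (λ q → ¬? (q ≟ p) ×-dec (adj T x q ≟ᵇ true))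
  ... | yes found = found
  ... | no none   =
    contradiction (ℕ.≤-trans 2≤deg (subst (_≤ 1) (sym deg≡xp) (toMulti-≤1 x p))) λ { (s≤s ()) }
    where
    deg≡xp : deg x ≡ toMulti T x p
    deg≡xp = sumℕ-single (toMulti T x) p λ q q≢p →
      toMulti-false (¬-not λ xq → none (q , q≢p , xq))

laplacian-diag : (E : MultiGraph n) (v : Fin n) → Laplacian E v v ≡ + degree E v
laplacian-diag E v with v ≟ v
... | yes _   = refl
... | no v≢v = contradiction refl v≢v

laplacian-off : (E : MultiGraph n) {v w : Fin n} → v ≢ w → Laplacian E v w ≡ - + E v w
laplacian-off E {v} {w} v≢w with v ≟ w
... | yes v≡w = contradiction v≡w v≢w
... | no _    = refl

module _ (T : SimpleGraph n) where

  private
    deg = degree (toMulti T)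

  cone-column : ∀ v i → reducedLaplacian (Cone T) i v ≡ + suc (deg v) * e v i - + toMulti T v i
  cone-column v i = by-cases (i ≟ v)
    where
    open ≡-Reasoning
    by-cases : Dec (i ≡ v) → reducedLaplacian (Cone T) i v ≡ + suc (deg v) * e v i - + toMulti T v i
    by-cases (yes refl) = begin
      reducedLaplacian (Cone T) i i           ≡⟨ laplacian-diag (Cone T) (suc i) ⟩
      + suc (deg i)                           ≡⟨ diag-identity (+ suc (deg i)) ⟩
      + suc (deg i) * + 1 - + 0
        ≡⟨ cong₂ (λ a b → + suc (deg i) * a - + b) (e-diag i) (toMulti-false T (irrefl T i)) ⟨
      + suc (deg i) * e i i - + toMulti T i i ∎
      where
      diag-identity : ∀ a → a ≡ a * + 1 - + 0
      diag-identity = solve-∀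
    by-cases (no i≢v) = begin
      reducedLaplacian (Cone T) i v           ≡⟨ laplacian-off (Cone T) (i≢v ∘ suc-injective) ⟩
      - + toMulti T i v                       ≡⟨ cong (λ a → - + a) (toMulti-sym T i v) ⟩
      - + toMulti T v i                       ≡⟨ off-identity (+ suc (deg v)) (+ toMulti T v i) ⟩
      + suc (deg v) * + 0 - + toMulti T v i
        ≡⟨ cong (λ a → + suc (deg v) * a - + toMulti T v i) (e-off (i≢v ∘ sym)) ⟨
      + suc (deg v) * e v i - + toMulti T v i ∎
      where
      off-identity : ∀ a b → - b ≡ a * + 0 - b
      off-identity = solve-∀

-- Isolated vertices are included so that every forest, not only every tree, is exhausted.
data Peelable (T : SimpleGraph n) (v₁ : Fin n) : Fin n → Set where
  start : ∀ {v} → degree (toMulti T) v ≤ 1 → v ≢ v₁ → Peelable T v₁ v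
  peel  : ∀ {v u} → adj T v u ≡ true → Peelable T v₁ v →
          (∀ q → adj T v q ≡ true → q ≢ u → Peelable T v₁ q) → Peelable T v₁ u

module _ (T : SimpleGraph n) (v₁ : Fin n) where

  open Congruence (Cone T)
  open Generation (Cone T) (λ v → IsLeaf T v × v ≢ v₁)

  private
    deg = degree (toMulti T)
    L̄ = reducedLaplacian (Cone T)

  isolated≈0 : ∀ {v} → deg v ≡ 0 → e v ≈ (λ _ → + 0)
  isolated≈0 {v} deg≡0 = ≈-trans (≈-reflexive e≗column) (column≈0 v)
    where
    no-neighbour : ∀ i → toMulti T v i ≡ 0
    no-neighbour i = ℕ.n≤0⇒n≡0 (subst (toMulti T v i ≤_) deg≡0 (≤-sumℕ (toMulti T v) i))
    unit-identity : ∀ a → a ≡ + 1 * a - + 0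
    unit-identity = solve-∀
    e≗column : ∀ i → e v i ≡ L̄ i v
    e≗column i = begin
      e v i                                   ≡⟨ unit-identity (e v i) ⟩
      + 1 * e v i - + 0                       ≡⟨ cong₂ (λ d t → + suc d * e v i - + t) deg≡0 (no-neighbour i) ⟨
      + suc (deg v) * e v i - + toMulti T v i ≡⟨ cone-column T v i ⟨
      L̄ i v                                   ∎
      where open ≡-Reasoning

  generated-peel : ∀ {v u} → adj T v u ≡ true → Generated (e v) →
                   (∀ q → adj T v q ≡ true → q ≢ u → Generated (e q)) → Generated (e u)
  generated-peel {v} {u} vu gen-v gen-others =
    generated-resp e-u≈ (generated-+ (generated-* (+ suc (deg v)) gen-v)
                                     (generated-* ℤ.-1ℤ (generated-sum (λ q i → b q * e q i) summand)))
    where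
    -- Column v of L̄ is (deg v + 1) e_v − Σ_{q ∼ v} e_q ≡ 0, so e_u ≡ (deg v + 1) e_v − Σ_q b q e_q
    -- with b q = 1 for the neighbours q ≠ u of v and b q = 0 otherwise.
    b : Fin n → ℤ
    b q = + toMulti T v q - e u q
    vanishing : ∀ {q} → b q ≡ + 0 → Generated (λ i → b q * e q i)
    vanishing {q} b≡0 =
      generated-resp (≈-reflexive λ i → trans (cong (_* e q i) b≡0) (ℤ.*-zeroˡ (e q i))) generated-zero
    summand : ∀ q → Generated (λ i → b q * e q i)
    summand q = by-cases (q ≟ u) (adj T v q ≟ᵇ true)
      where
      by-cases : Dec (q ≡ u) → Dec (adj T v q ≡ true) → Generated (λ i → b q * e q i)
      by-cases (yes refl) _        = vanishing (cong₂ _-_ (cong +_ (toMulti-true T vu)) (e-diag q))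
      by-cases (no q≢u)   (yes vq) = generated-* (b q) (gen-others q vq q≢u)
      by-cases (no q≢u)   (no ¬vq) =
        vanishing (cong₂ _-_ (cong +_ (toMulti-false T (¬-not ¬vq))) (e-off (q≢u ∘ sym)))
    peel-identity : ∀ x s ev t → x + (s * ev - t) ≡ s * ev + ℤ.-1ℤ * (t - x)
    peel-identity = solve-∀
    column-rearranged : ∀ i → e u i + L̄ i v ≡ + suc (deg v) * e v i + ℤ.-1ℤ * sumℤ (λ q → b q * e q i)
    column-rearranged i = begin
      e u i + L̄ i v
        ≡⟨ cong (_+_ (e u i)) (cone-column T v i) ⟩
      e u i + (+ suc (deg v) * e v i - + toMulti T v i)
        ≡⟨ peel-identity (e u i) (+ suc (deg v)) (e v i) (+ toMulti T v i) ⟩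
      + suc (deg v) * e v i + ℤ.-1ℤ * b i
        ≡⟨ cong (λ t → + suc (deg v) * e v i + ℤ.-1ℤ * t) (sumℤ-*e b i) ⟨
      + suc (deg v) * e v i + ℤ.-1ℤ * sumℤ (λ q → b q * e q i) ∎
      where open ≡-Reasoning
    e-u≈ : e u ≈ (λ i → + suc (deg v) * e v i + ℤ.-1ℤ * sumℤ (λ q → b q * e q i))
    e-u≈ = begin
      e u                   ≈⟨ ≈-reflexive (λ i → sym (ℤ.+-identityʳ (e u i))) ⟩
      (λ i → e u i + + 0)   ≈⟨ ≈-+ (≈-refl {e u}) (column≈0 v) ⟨
      (λ i → e u i + L̄ i v) ≈⟨ ≈-reflexive column-rearranged ⟩
      (λ i → + suc (deg v) * e v i + ℤ.-1ℤ * sumℤ (λ q → b q * e q i)) ∎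
      where open import Relation.Binary.Reasoning.Setoid ≈-setoid

  peelable⇒generated : ∀ {v} → Peelable T v₁ v → Generated (e v)
  peelable⇒generated (start deg≤1 v≢v₁) with ℕ.m≤n⇒m<n∨m≡n deg≤1
  ... | inj₁ (s≤s deg≤0) = generated-resp (isolated≈0 (ℕ.n≤0⇒n≡0 deg≤0)) generated-zero
  ... | inj₂ deg≡1       = generated-e (deg≡1 , v≢v₁)
  peelable⇒generated (peel vu peelable-v peelable-others) =
    generated-peel vu (peelable⇒generated peelable-v) λ q vq q≢u → peelable⇒generated (peelable-others q vq q≢u)

least-witness : {P : ℕ → Set} → (∀ k → Dec (P k)) → ∀ {m} → P m →
                ∃ λ k → P k × (∀ j → j < k → ¬ P j)
least-witness {P} P? {m} pm = search m 0 (λ _ ()) pm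
  where
  search : ∀ d k → (∀ j → j < k → ¬ P j) → P (k ℕ.+ d) → ∃ λ k → P k × (∀ j → j < k → ¬ P j)
  search d k below p with P? k
  ... | yes pk = k , pk , below
  search zero    k below p | no ¬pk = contradiction (subst P (ℕ.+-identityʳ k) p) ¬pk
  search (suc d) k below p | no ¬pk = search d (suc k) below′ (subst P (ℕ.+-suc k d) p)
    where
    below′ : ∀ j → j < suc k → ¬ P j
    below′ j (s≤s j≤k) with ℕ.m≤n⇒m<n∨m≡n j≤k
    ... | inj₁ j<k  = below j j<k
    ... | inj₂ refl = ¬pk

module _ (G : SimpleGraph n) (w : ℕ → Fin n)
         (adjacent : ∀ k → adj G (w k) (w (suc k)) ≡ true)
         (turns : ∀ k → w (suc k) ≢ w 0 → w (suc (suc k)) ≢ w k) where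

  private
    Repeats : ℕ → Set
    Repeats J = ∃ λ (i : Fin J) → w (toℕ i) ≡ w J

    repeats-below : ∀ {a b} → a < b → w a ≡ w b → Repeats b
    repeats-below a<b wa≡wb = fromℕ< a<b , trans (cong w (toℕ-fromℕ< a<b)) wa≡wb

    repeats? : ∀ J → Dec (Repeats J)
    repeats? J = any? (λ i → w (toℕ i) ≟ w J)

    some-repeat : ∃ Repeats
    some-repeat =
      let i , j , i<j , wi≡wj = pigeonhole (ℕ.n<1+n n) (w ∘ toℕ) in toℕ j , repeats-below i<j wi≡wj

    injective-before : ∀ {J} → (∀ j → j < J → ¬ Repeats j) →
                       ∀ {a b} → a < J → b < J → w a ≡ w b → a ≡ b
    injective-before minimal {a} {b} a<J b<J wa≡wb with ℕ.<-cmp a b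
    ... | tri< a<b _ _ = contradiction (repeats-below a<b wa≡wb) (minimal b b<J)
    ... | tri≈ _ a≡b _ = a≡b
    ... | tri> _ _ b<a = contradiction (repeats-below b<a (sym wa≡wb)) (minimal a a<J)

    closed-segment-cycle : ∀ {I J} len → suc I ℕ.+ suc (suc len) ≡ J →
                           (∀ {a b} → a < J → b < J → w a ≡ w b → a ≡ b) → w I ≡ w J → Cycle G
    closed-segment-cycle {I} {J} len I+len+3≡J injective wI≡wJ =
      record { len = len ; verts = verts ; inj = inj ; edges = edges ; close = close }
      where
      bound : ∀ {k} → k < suc (suc (suc len)) → I ℕ.+ k < J
      bound k<len+3 = subst (I ℕ.+ _ <_) (trans (ℕ.+-suc I (suc (suc len))) I+len+3≡J) (ℕ.+-monoʳ-< I k<len+3)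
      verts : Fin (suc (suc (suc len))) → Fin n
      verts k = w (I ℕ.+ toℕ k)
      inj : ∀ {a b} → verts a ≡ verts b → a ≡ b
      inj {a} {b} eq =
        toℕ-injective (ℕ.+-cancelˡ-≡ I (toℕ a) (toℕ b) (injective (bound (toℕ<n a)) (bound (toℕ<n b)) eq))
      edges : ∀ (k : Fin (suc (suc len))) → adj G (verts (inject₁ k)) (verts (suc k)) ≡ true
      edges k rewrite toℕ-inject₁ k | ℕ.+-suc I (toℕ k) = adjacent (I ℕ.+ toℕ k)
      close : adj G (verts (fromℕ (suc (suc len)))) (verts zero) ≡ true
      close rewrite toℕ-fromℕ (suc (suc len)) | ℕ.+-identityʳ I =
        subst (λ x → adj G (w (I ℕ.+ suc (suc len))) x ≡ true) (trans (cong w I+len+3≡J) (sym wI≡wJ)) (adjacent _)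

  -- At the first repetition w I = w J, write J = I + 1 + o: o = 0 is a loop, o = 1 a backtrack,
  -- and otherwise w I, …, w (J − 1) is a cycle.
  walk⇒cycle : Cycle G
  walk⇒cycle with least-witness repeats? (proj₂ some-repeat)
  ... | J , (i , wI≡wJ) , minimal with ℕ.m≤n⇒∃[o]m+o≡n (toℕ<n i)
  ...   | zero , I+1≡J =
    contradiction (trans wI≡wJ (cong w (sym I+1≡J′))) (no-loop G (adjacent (toℕ i)))
    where
    I+1≡J′ : suc (toℕ i) ≡ J
    I+1≡J′ = trans (cong suc (sym (ℕ.+-identityʳ (toℕ i)))) I+1≡J
  ...   | suc zero , I+2≡J = contradiction (trans (cong w I+2≡J′) (sym wI≡wJ)) (turns (toℕ i) w1+I≢w0)
    where
    I+2≡J′ : suc (suc (toℕ i)) ≡ J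
    I+2≡J′ = trans (cong suc (ℕ.+-comm 1 (toℕ i))) I+2≡J
    w1+I≢w0 : w (suc (toℕ i)) ≢ w 0
    w1+I≢w0 eq with () ← injective-before minimal (subst (suc (toℕ i) <_) I+2≡J′ (ℕ.n<1+n _))
                                                   (subst (0 <_) I+2≡J′ (s≤s z≤n)) eq
  ...   | suc (suc len) , I+len+3≡J = closed-segment-cycle len I+len+3≡J (injective-before minimal) wI≡wJ

module _ (G : SimpleGraph n) (H : Fin n → Fin n → Set) (H⇒adj : ∀ {x y} → H x y → adj G x y ≡ true)
         {s t : Fin n} (st : H s t)
         (continue : ∀ {p x} → x ≢ s → H p x → ∃ λ q → H x q × q ≢ p) where

  private
    Edge : Set
    Edge = ∃₂ H

    -- On returning to s the walk restarts along s t.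
    next : Edge → Edge
    next (p , x , px) with x ≟ s
    ... | yes _   = s , t , st
    ... | no x≢s = let q , xq , _ = continue x≢s px in x , q , xq

    edge : ℕ → Edge
    edge zero    = s , t , st
    edge (suc k) = next (edge k)

    w : ℕ → Fin n
    w = proj₁ ∘ edge

    next-starts-at-end : ∀ ε → proj₁ (next ε) ≡ proj₁ (proj₂ ε)
    next-starts-at-end (p , x , px) with x ≟ s
    ... | yes x≡s = sym x≡s
    ... | no _    = refl

    next-turns : ∀ ε → proj₁ (proj₂ ε) ≢ s → proj₁ (proj₂ (next ε)) ≢ proj₁ ε
    next-turns (p , x , px) x≢s with x ≟ s
    ... | yes x≡s  = contradiction x≡s x≢s
    ... | no x≢s′ = proj₂ (proj₂ (continue x≢s′ px))

  nonbacktracking⇒cycle : Cycle G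
  nonbacktracking⇒cycle = walk⇒cycle G w adjacent turns
    where
    adjacent : ∀ k → adj G (w k) (w (suc k)) ≡ true
    adjacent k = subst (λ y → adj G (w k) y ≡ true) (sym (next-starts-at-end (edge k)))
                       (H⇒adj (proj₂ (proj₂ (edge k))))
    turns : ∀ k → w (suc k) ≢ w 0 → w (suc (suc k)) ≢ w k
    turns k w1+k≢s = subst (_≢ w k) (sym (next-starts-at-end (next (edge k))))
                           (next-turns (edge k) (subst (_≢ s) (next-starts-at-end (edge k)) w1+k≢s))

module Saturation (T : SimpleGraph n) (v₁ : Fin n) (leaf : IsLeaf T v₁) where

  private
    deg = degree (toMulti T)

  Derivable : Subset n → Fin n → Set
  Derivable W u = (deg u ≤ 1 × u ≢ v₁)
                ⊎ ∃ λ v → v ∈ W × adj T v u ≡ true × (∀ q → adj T v q ≡ true → q ≢ u → q ∈ W)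

  derivable? : ∀ W u → Dec (Derivable W u)
  derivable? W u = (deg u ℕ.≤? 1 ×-dec ¬? (u ≟ v₁))
    ⊎-dec any? λ v → v ∈? W ×-dec adj T v u ≟ᵇ true
                      ×-dec all? λ q → adj T v q ≟ᵇ true →-dec ¬? (q ≟ u) →-dec q ∈? W

  derivable⇒peelable : ∀ {W u} → Lift (Peelable T v₁) W → Derivable W u → Peelable T v₁ u
  derivable⇒peelable sound (inj₁ (deg≤1 , u≢v₁))             = start deg≤1 u≢v₁
  derivable⇒peelable sound (inj₂ (v , v∈W , vu , others∈W)) =
    peel vu (sound v∈W) λ q vq q≢u → sound (others∈W q vq q≢u)

  stuck⇒cycle : ∀ {W u₀} → (∀ u → u ∉ W → ¬ Derivable W u) → u₀ ∉ W → Cycle T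
  stuck⇒cycle {W} {u₀} stuck u₀∉W with walk-start
    where
    branching : ∀ {x} → x ∉ W → x ≢ v₁ → 2 ≤ deg x
    branching {x} x∉W x≢v₁ with deg x ℕ.≤? 1
    ... | yes deg≤1 = contradiction (inj₁ (deg≤1 , x≢v₁)) (stuck x x∉W)
    ... | no deg≰1  = ℕ.≰⇒> deg≰1
    -- v₁ is the only vertex outside W that may have degree 1, so the walk starts there if it can.
    walk-start : ∃ λ s → s ∉ W × 1 ≤ deg s × (∀ {x} → x ∉ W → x ≢ s → 2 ≤ deg x)
    walk-start with v₁ ∈? W
    ... | no v₁∉W  = v₁ , v₁∉W , ℕ.≤-reflexive (sym leaf) , branching
    ... | yes v₁∈W =
      u₀ , u₀∉W , ℕ.≤-trans (s≤s z≤n) (branching u₀∉W (≢v₁ u₀∉W)) ,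
      λ x∉W _ → branching x∉W (≢v₁ x∉W)
      where
      ≢v₁ : ∀ {x} → x ∉ W → x ≢ v₁
      ≢v₁ x∉W refl = x∉W v₁∈W
  ... | s , s∉W , 1≤deg-s , branching-elsewhere =
    nonbacktracking⇒cycle T Crosses proj₁ (proj₂ (has-neighbour T 1≤deg-s) , inj₁ s∉W) continue
    where
    Crosses : Fin n → Fin n → Set
    Crosses x y = adj T x y ≡ true × (x ∉ W ⊎ y ∉ W)
    continue : ∀ {p x} → x ≢ s → Crosses p x → ∃ λ q → Crosses x q × q ≢ p
    continue {p} {x} x≢s (px , p∉W⊎x∉W) with x ∈? W
    ... | no x∉W =
      let q , q≢p , xq = has-other-neighbour T (branching-elsewhere x∉W x≢s) p in q , (xq , inj₁ x∉W) , q≢p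
    ... | yes x∈W with p∉W⊎x∉W
    ...   | inj₂ x∉W = contradiction x∈W x∉W
    ...   | inj₁ p∉W with any? (λ q → adj T x q ≟ᵇ true ×-dec ¬? (q ≟ p) ×-dec ¬? (q ∈? W))
    ...     | yes (q , xq , q≢p , q∉W) = q , (xq , inj₂ q∉W) , q≢p
    ...     | no none = contradiction (inj₂ (x , x∈W , trans (symmetric T x p) px , others∈W)) (stuck p p∉W)
      where
      others∈W : ∀ q → adj T x q ≡ true → q ≢ p → q ∈ W
      others∈W q xq q≢p = decidable-stable (q ∈? W) λ q∉W → none (q , xq , q≢p , q∉W)

  saturate : Acyclic T → ∀ W → Acc _⊃_ W → Lift (Peelable T v₁) W → ∀ v → Peelable T v₁ v
  saturate acyclic W (acc larger) sound with any? (λ u → ¬? (u ∈? W) ×-dec derivable? W u)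
  ... | yes (u , u∉W , derivable) = saturate acyclic (W ∪ ⁅ u ⁆) (larger W⊂W∪u) sound∪u
    where
    W⊂W∪u : W ⊂ W ∪ ⁅ u ⁆
    W⊂W∪u = p⊆p∪q ⁅ u ⁆ , u , x∈p∪q⁺ (inj₂ (x∈⁅x⁆ u)) , u∉W
    sound∪u : Lift (Peelable T v₁) (W ∪ ⁅ u ⁆)
    sound∪u x∈W∪u with x∈p∪q⁻ W ⁅ u ⁆ x∈W∪u
    ... | inj₁ x∈W = sound x∈W
    ... | inj₂ x∈u rewrite x∈⁅y⁆⇒x≡y u x∈u = derivable⇒peelable sound derivable
  ... | no none = every-vertex
    where
    every-vertex : ∀ v → Peelable T v₁ v
    every-vertex v with v ∈? W
    ... | yes v∈W = sound v∈W
    ... | no v∉W  = contradiction (stuck⇒cycle (λ u u∉W derivable → none (u , u∉W , derivable)) v∉W) acyclic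

  all-peelable : Acyclic T → ∀ v → Peelable T v₁ v
  all-peelable acyclic = saturate acyclic Subset.⊥ (⊃-wellFounded Subset.⊥) λ x∈⊥ → contradiction x∈⊥ ∉⊥

module _ (T : SimpleGraph n) (v₁ : Fin n) where

  open Generation (Cone T) (λ v → IsLeaf T v × v ≢ v₁)

  forest-cone-generated-by-leaves : Acyclic T → IsLeaf T v₁ → ∀ x → Generated x
  forest-cone-generated-by-leaves acyclic leaf =
    generated-from-basis λ v → peelable⇒generated T v₁ (Saturation.all-peelable T v₁ leaf acyclic v)

theorem1p1 : (n : ℕ) → 2 ≤ n → (T : SimpleGraph n) → IsTree T →
    (v₁ : Fin n) → IsLeaf T v₁ →
    (x : Fin n → ℤ) →
    ∃ λ (c : Fin n → ℤ) →
    (∀ v → (IsLeaf T v × v ≢ v₁) ⊎ c v ≡ + 0) ×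
    (x ≡[mod Cone T ] (λ w → sumℤ (λ v → c v * e v w)))
theorem1p1 n _ T (_ , acyclic) v₁ leaf x =
  let generated c supported x≈c = forest-cone-generated-by-leaves T v₁ acyclic leaf x
  in  c , supported , _≈_.congruence (≈-trans x≈c (≈-reflexive (sym ∘ sumℤ-*e c)))
  where
  open Congruence (Cone T)
  open Generation (Cone T) (λ v → IsLeaf T v × v ≢ v₁)
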